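{- For every integer $k\geq 2$ there exists a graph $G$ with minimum degree $\delta(G)\geq k^2-1$ which is not $\frac{1}{k}$-majority $(k+1)$-edge-colourable.
   Context: Graphs are finite and simple. For an integer $k\geq 2$, a $\frac{1}{k}$-majority $l$-edge-colouring of a graph $G$ is an assignment to each edge of $G$ of one of $l$ colours such that for every colour $i$ and every vertex $v$ of $G$, at most $\frac{d_G(v)}{k}$ of the edges incident with $v$ have colour $i$ (where $d_G(v)$ is the degree of $v$). $G$ is $\frac{1}{k}$-majority $l$-edge-colourable if such a colouring exists. -}

module Defs where

open import Data.Nat using (ℕ; zero; suc; _+_; _*_; _≤_)
open import Data.Fin using (Fin; zero; suc)
open import Data.Bool using (Bool; true; false; if_then_else_; _∧_)
open import Data.Product using (Σ; _×_)
open import Relation.Binary.PropositionalEquality using (_≡_)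
open import Relation.Nullary using (¬_)

record Graph : Set where
  field
    n     : ℕ
    adj   : Fin n → Fin n → Bool
    sym   : ∀ u v → adj u v ≡ adj v u
    irrefl : ∀ v → adj v v ≡ false
open Graph public

count : ∀ {m} → (Fin m → Bool) → ℕ
count {zero}  p = 0
count {suc m} p = (if p zero then 1 else 0) + count (λ x → p (suc x))

deg : (G : Graph) → Fin (n G) → ℕ
deg G v = count (adj G v)

minDeg≥ : Graph → ℕ → Set
minDeg≥ G d = ∀ v → d ≤ deg G v

-- an l-edge-colouring: a colour for each edge {u,v}, given as a function on
-- ordered pairs that is symmetric on edges (its value on non-edges is irrelevant)
record EdgeColouring (G : Graph) (l : ℕ) : Set where
  field
    col : Fin (n G) → Fin (n G) → Fin l
    col-sym : ∀ u v → adj G u v ≡ true → col u v ≡ col v u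
open EdgeColouring public

_≟c_ : ∀ {l} → Fin l → Fin l → Bool
zero  ≟c zero  = true
zero  ≟c suc _ = false
suc _ ≟c zero  = false
suc a ≟c suc b = a ≟c b

degCol : (G : Graph) {l : ℕ} → EdgeColouring G l → Fin (n G) → Fin l → ℕ
degCol G c v i = count (λ u → adj G v u ∧ (col c v u ≟c i))

-- 1/k-majority: for every colour i and vertex v, (#edges at v of colour i) ≤ d(v)/k,
-- i.e. k * (#edges at v of colour i) ≤ d(v)
IsMajority : (k : ℕ) (G : Graph) {l : ℕ} → EdgeColouring G l → Set
IsMajority k G c = ∀ v i → k * degCol G c v i ≤ deg G v

MajorityColourable : (k : ℕ) (G : Graph) (l : ℕ) → Set
MajorityColourable k G l = Σ (EdgeColouring G l) (λ c → IsMajority k G c)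

-- Let N = k² + 1 and let G be the cone over the complement of the cycle C_N. The
-- N cycle vertices have degree k² − 1 = (k + 1)(k − 1), and a 1/k-majority colour
-- class has fewer than k edges at such a vertex, so with k + 1 colours every colour
-- appears exactly k − 1 times there. At the apex each colour appears at most k
-- times; exactly k is impossible, since the degree sum k + N(k − 1) of that colour
-- class would be odd. So the apex has at most (k + 1)(k − 1) < N edges in total.
module Submission where

open import Defs hiding (sym)
open import Data.Nat using (ℕ; zero; suc; _≤_; _<_; _*_; _∸_; _+_; s≤s; z≤n; z<s; s≤s⁻¹; parity)
open import Data.Nat.Properties
open import Data.Nat.Divisibility using (_∣_; divides; ∣m∣n⇒∣m+n)
open import Data.Nat.Tactic.RingSolver using (solve-∀)
open import Data.Parity using (0ℙ; 1ℙ)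
open import Data.Parity.Properties using (+-homo-+; *-homo-*; suc-homo-⁻¹)
import Data.Parity.Properties as ℙ
open import Data.Fin using (Fin; zero; suc; toℕ; punchIn)
open import Data.Fin.Properties using (toℕ<n)
open import Data.Bool using (Bool; true; false; if_then_else_; _∧_; _∨_; not)
open import Data.Bool.Properties using (∨-comm; ∨-inverseˡ; ∧-inverseˡ; ∧-distribˡ-∨)
open import Data.Product using (Σ; _×_; _,_)
open import Data.Vec.Functional using (removeAt)
open import Function using (_∘_; mk⇔)
open import Relation.Nullary using (¬_; Dec; yes; no; contradiction)
open import Relation.Nullary.Decidable using (does; dec-true; dec-false; does-⇔)
open import Relation.Binary.PropositionalEquality
open import Algebra.Properties.CommutativeMonoid.Sum +-0-commutativeMonoid
  using (sum; sum-syntax; sum-cong-≗; sum-remove; sum-replicate-zero; ∑-comm; ∑-distrib-+)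

indicator : Bool → ℕ
indicator b = if b then 1 else 0

indicator-∨ : ∀ a b → a ∧ b ≡ false → indicator (a ∨ b) ≡ indicator a + indicator b
indicator-∨ true  false _ = refl
indicator-∨ false b     _ = refl

count≡∑ : ∀ {m} (p : Fin m → Bool) → count p ≡ ∑[ x < m ] indicator (p x)
count≡∑ {zero}  p = refl
count≡∑ {suc m} p = cong (indicator (p zero) +_) (count≡∑ (p ∘ suc))

count-cong : ∀ {m} {p q : Fin m → Bool} → (∀ x → p x ≡ q x) → count p ≡ count q
count-cong {zero}  eq = refl
count-cong {suc m} eq = cong₂ (λ b c → indicator b + c) (eq zero) (count-cong (eq ∘ suc))

count-true : ∀ m → count {m} (λ _ → true) ≡ m
count-true zero    = refl
count-true (suc m) = cong suc (count-true m)

count-false : ∀ m → count {m} (λ _ → false) ≡ 0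
count-false zero    = refl
count-false (suc m) = count-false m

count-∨ : ∀ {m} (p q : Fin m → Bool) → (∀ x → p x ∧ q x ≡ false) →
          count (λ x → p x ∨ q x) ≡ count p + count q
count-∨ {m} p q disjoint = begin
  count (λ x → p x ∨ q x)
    ≡⟨ count≡∑ (λ x → p x ∨ q x) ⟩
  ∑[ x < m ] indicator (p x ∨ q x)
    ≡⟨ sum-cong-≗ (λ x → indicator-∨ (p x) (q x) (disjoint x)) ⟩
  ∑[ x < m ] (indicator (p x) + indicator (q x))
    ≡⟨ ∑-distrib-+ (indicator ∘ p) (indicator ∘ q) ⟩
  ∑[ x < m ] indicator (p x) + ∑[ x < m ] indicator (q x)
    ≡⟨ cong₂ _+_ (count≡∑ p) (count≡∑ q) ⟨
  count p + count q ∎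
  where open ≡-Reasoning

count-not : ∀ {m} (p : Fin m → Bool) → count (not ∘ p) + count p ≡ m
count-not {m} p = begin
  count (not ∘ p) + count p      ≡⟨ count-∨ (not ∘ p) p (∧-inverseˡ ∘ p) ⟨
  count (λ x → not (p x) ∨ p x)  ≡⟨ count-cong (∨-inverseˡ ∘ p) ⟩
  count {m} (λ _ → true)         ≡⟨ count-true m ⟩
  m                              ∎
  where open ≡-Reasoning

count-toℕ≡ : ∀ {m} t → t < m → count {m} (λ x → does (toℕ x ≟ t)) ≡ 1
count-toℕ≡ {suc m} zero    _ = cong suc (count-false m)
count-toℕ≡ {suc m} (suc t) t<m = count-toℕ≡ t (s≤s⁻¹ t<m)

∑-const : ∀ m b → ∑[ i < m ] b ≡ m * b
∑-const zero    b = refl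
∑-const (suc m) b = cong (b +_) (∑-const m b)

∑-≤ : ∀ {l} {f : Fin l → ℕ} {b} → (∀ i → f i ≤ b) → ∑[ i < l ] f i ≤ l * b
∑-≤ {zero}  f≤b = z≤n
∑-≤ {suc l} f≤b = +-mono-≤ (f≤b zero) (∑-≤ (f≤b ∘ suc))

∑-tight : ∀ {l} (f : Fin l → ℕ) {b} → (∀ i → f i ≤ b) → ∑[ i < l ] f i ≡ l * b →
          ∀ j → f j ≡ b
∑-tight {suc l} f {b} f≤b ∑≡ j = ≤-antisym (f≤b j) (+-cancelʳ-≤ (l * b) b (f j) (begin
  b + l * b                  ≡⟨ ∑≡ ⟨
  ∑[ i < suc l ] f i         ≡⟨ sum-remove {i = j} f ⟩
  f j + sum (removeAt f j)   ≤⟨ +-monoʳ-≤ (f j) (∑-≤ (f≤b ∘ punchIn j)) ⟩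
  f j + l * b                ∎))
  where open ≤-Reasoning

∑-indicator-≟c : ∀ {l} (x : Fin l) → ∑[ i < l ] indicator (x ≟c i) ≡ 1
∑-indicator-≟c {suc l} zero    = cong suc (sum-replicate-zero l)
∑-indicator-≟c {suc l} (suc x) = ∑-indicator-≟c x

∑-count-fibres : ∀ {m l} (p : Fin m → Bool) (f : Fin m → Fin l) →
                 ∑[ i < l ] count (λ u → p u ∧ (f u ≟c i)) ≡ count p
∑-count-fibres {m} {l} p f = begin
  ∑[ i < l ] count (λ u → p u ∧ (f u ≟c i))
    ≡⟨ sum-cong-≗ (λ i → count≡∑ (λ u → p u ∧ (f u ≟c i))) ⟩
  ∑[ i < l ] ∑[ u < m ] indicator (p u ∧ (f u ≟c i))
    ≡⟨ ∑-comm (λ u i → indicator (p u ∧ (f u ≟c i))) ⟨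
  ∑[ u < m ] ∑[ i < l ] indicator (p u ∧ (f u ≟c i))
    ≡⟨ sum-cong-≗ (λ u → fibre (p u) (f u)) ⟩
  ∑[ u < m ] indicator (p u)
    ≡⟨ count≡∑ p ⟨
  count p ∎
  where
  open ≡-Reasoning
  fibre : ∀ b x → ∑[ i < l ] indicator (b ∧ (x ≟c i)) ≡ indicator b
  fibre true  x = ∑-indicator-≟c x
  fibre false x = sum-replicate-zero l

∑-degCol≡deg : (G : Graph) {l : ℕ} (c : EdgeColouring G l) (v : Fin (n G)) →
               ∑[ i < l ] degCol G c v i ≡ deg G v
∑-degCol≡deg G c v = ∑-count-fibres (adj G v) (col c v)

-- Vertex 0 contributes c = deg 0 to its own count and, by symmetry, c in total to the
-- counts of the other vertices.
handshake-relation : ∀ {m} (R : Fin m → Fin m → Bool) → (∀ u w → R u w ≡ R w u) →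
                     (∀ u → R u u ≡ false) → 2 ∣ ∑[ u < m ] count (R u)
handshake-relation {zero}  R R-sym R-irrefl = divides 0 refl
handshake-relation {suc m} R R-sym R-irrefl =
  subst (2 ∣_) (sym split)
    (∣m∣n⇒∣m+n (divides c c+c≡c*2) (handshake-relation R′ R′-sym (R-irrefl ∘ suc)))
  where
  open ≡-Reasoning
  R′ : Fin m → Fin m → Bool
  R′ u w = R (suc u) (suc w)
  R′-sym : ∀ u w → R′ u w ≡ R′ w u
  R′-sym u w = R-sym (suc u) (suc w)
  c : ℕ
  c = count (λ w → R zero (suc w))
  c+c≡c*2 : c + c ≡ c * 2
  c+c≡c*2 = trans (cong (c +_) (sym (+-identityʳ c))) (*-comm 2 c)
  column : ∑[ u < m ] indicator (R (suc u) zero) ≡ c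
  column = trans (sum-cong-≗ (λ u → cong indicator (R-sym (suc u) zero)))
                 (sym (count≡∑ (λ w → R zero (suc w))))
  split : ∑[ u < suc m ] count (R u) ≡ (c + c) + ∑[ u < m ] count (R′ u)
  split = begin
    indicator (R zero zero) + c + ∑[ u < m ] (indicator (R (suc u) zero) + count (R′ u))
      ≡⟨ cong₂ (λ b s → indicator b + c + s) (R-irrefl zero)
               (∑-distrib-+ (λ u → indicator (R (suc u) zero)) (count ∘ R′)) ⟩
    c + (∑[ u < m ] indicator (R (suc u) zero) + ∑[ u < m ] count (R′ u))
      ≡⟨ cong (λ s → c + (s + ∑[ u < m ] count (R′ u))) column ⟩
    c + (c + ∑[ u < m ] count (R′ u))
      ≡⟨ +-assoc c c _ ⟨
    (c + c) + ∑[ u < m ] count (R′ u) ∎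

handshake : (G : Graph) → 2 ∣ ∑[ v < n G ] deg G v
handshake G = handshake-relation (adj G) (Graph.sym G) (irrefl G)

parity-even : ∀ {x} → 2 ∣ x → parity x ≡ 0ℙ
parity-even (divides q refl) = trans (*-homo-* q 2) (ℙ.*-zeroʳ (parity q))

k+[k*k+1]*[k∸1]-odd : ∀ k → 1 ≤ k → parity (k + (k * k + 1) * (k ∸ 1)) ≡ 1ℙ
k+[k*k+1]*[k∸1]-odd (suc m) _
  rewrite +-homo-+ (suc m) ((suc m * suc m + 1) * m) | *-homo-* (suc m * suc m + 1) m
        | +-homo-+ (suc m * suc m) 1 | *-homo-* (suc m) (suc m)
        | sym (ℙ.⁻¹-selfInverse (suc-homo-⁻¹ m))
  with parity m
... | 0ℙ = refl
... | 1ℙ = refl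

colourClass-sym : (G : Graph) {l : ℕ} (c : EdgeColouring G l) (i : Fin l) (u w : Fin (n G)) →
                  adj G u w ∧ (col c u w ≟c i) ≡ adj G w u ∧ (col c w u ≟c i)
colourClass-sym G c i u w with adj G u w in uw
... | true  rewrite Graph.sym G w u | uw | col-sym c u w uw = refl
... | false rewrite Graph.sym G w u | uw = refl

colourClass : (G : Graph) {l : ℕ} → EdgeColouring G l → Fin l → Graph
colourClass G c i = record
  { n      = n G
  ; adj    = λ u w → adj G u w ∧ (col c u w ≟c i)
  ; sym    = colourClass-sym G c i
  ; irrefl = λ u → cong (_∧ (col c u u ≟c i)) (irrefl G u)
  }

module _ (k : ℕ) (G : Graph) {l : ℕ} (c : EdgeColouring G l) (maj : IsMajority k G c) where

  degCol-≤ : ∀ v b → deg G v < k * suc b → ∀ i → degCol G c v i ≤ b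
  degCol-≤ v b deg< i = s≤s⁻¹ (*-cancelˡ-< k _ _ (≤-<-trans (maj v i) deg<))

  degCol-≡ : ∀ v b → deg G v ≡ l * b → deg G v < k * suc b → ∀ i → degCol G c v i ≡ b
  degCol-≡ v b deg≡ deg< =
    ∑-tight (degCol G c v) (degCol-≤ v b deg<) (trans (∑-degCol≡deg G c v) deg≡)

cone : Graph → Graph
cone H = record { n = suc (n H) ; adj = adjᶜ ; sym = symᶜ ; irrefl = irreflᶜ }
  where
  adjᶜ : Fin (suc (n H)) → Fin (suc (n H)) → Bool
  adjᶜ zero    zero    = false
  adjᶜ zero    (suc _) = true
  adjᶜ (suc _) zero    = true
  adjᶜ (suc u) (suc w) = adj H u w
  symᶜ : ∀ u w → adjᶜ u w ≡ adjᶜ w u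
  symᶜ zero    zero    = refl
  symᶜ zero    (suc w) = refl
  symᶜ (suc u) zero    = refl
  symᶜ (suc u) (suc w) = Graph.sym H u w
  irreflᶜ : ∀ u → adjᶜ u u ≡ false
  irreflᶜ zero    = refl
  irreflᶜ (suc u) = irrefl H u

deg-cone-apex : (H : Graph) → deg (cone H) zero ≡ n H
deg-cone-apex H = count-true (n H)

cycleSuc : ℕ → ℕ → ℕ
cycleSuc N x with suc x ≟ N
... | yes _ = 0
... | no  _ = suc x

cyclePred : ℕ → ℕ → ℕ
cyclePred N zero    = N ∸ 1
cyclePred N (suc x) = x

cyclePred-cycleSuc : ∀ N x → cyclePred N (cycleSuc N x) ≡ x
cyclePred-cycleSuc N x with suc x ≟ N
... | yes refl = refl
... | no  _    = refl

cycleSuc-cyclePred : ∀ {N x} → x < N → cycleSuc N (cyclePred N x) ≡ x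
cycleSuc-cyclePred {suc N} {zero} _ with suc N ≟ suc N
... | yes _    = refl
... | no  N≢N  = contradiction refl N≢N
cycleSuc-cyclePred {N} {suc x} x<N with suc x ≟ N
... | yes refl = contradiction x<N (<-irrefl refl)
... | no  _    = refl

cycleSuc-< : ∀ {N x} → x < N → cycleSuc N x < N
cycleSuc-< {N} {x} x<N with suc x ≟ N
... | yes _      = ≤-<-trans z≤n x<N
... | no  1+x≢N = ≤∧≢⇒< x<N 1+x≢N

cyclePred-< : ∀ {N x} → x < N → cyclePred N x < N
cyclePred-< {suc N} {zero}  _   = n<1+n N
cyclePred-< {N}     {suc x} x<N = <⇒≤ x<N

module _ {r : ℕ} where
  private
    N = 3 + r

  cycleSuc-≢ : ∀ x → x ≢ cycleSuc N x
  cycleSuc-≢ x with suc x ≟ N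
  ... | yes refl = λ ()
  ... | no  _    = 1+n≢n ∘ sym

  cyclePred-≢ : ∀ x → x ≢ cyclePred N x
  cyclePred-≢ zero    = λ ()
  cyclePred-≢ (suc x) = 1+n≢n

  cycleSuc≢cyclePred : ∀ x → cycleSuc N x ≢ cyclePred N x
  cycleSuc≢cyclePred zero with 1 ≟ N
  ... | yes ()
  ... | no  _ = λ ()
  cycleSuc≢cyclePred (suc x) with suc (suc x) ≟ N
  ... | yes refl = λ ()
  ... | no  _    = λ eq → <-irrefl (sym eq) (m<n+m x {2} z<s)

cycleNear : ℕ → ℕ → ℕ → Bool
cycleNear N x y = does (x ≟ y) ∨ does (cycleSuc N x ≟ y) ∨ does (cycleSuc N y ≟ x)

cycleNear-sym : ∀ N x y → cycleNear N x y ≡ cycleNear N y x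
cycleNear-sym N x y = cong₂ _∨_ (does-⇔ (mk⇔ sym sym) (x ≟ y) (y ≟ x))
  (∨-comm (does (cycleSuc N x ≟ y)) (does (cycleSuc N y ≟ x)))

cycleNear-refl : ∀ N x → cycleNear N x x ≡ true
cycleNear-refl N x =
  cong (_∨ (does (cycleSuc N x ≟ x) ∨ does (cycleSuc N x ≟ x))) (dec-true (x ≟ x) refl)

cycleNear-≟ : ∀ N {a} x → a < N →
              cycleNear N a x
                ≡ does (x ≟ a) ∨ does (x ≟ cycleSuc N a) ∨ does (x ≟ cyclePred N a)
cycleNear-≟ N {a} x a<N = cong₂ _∨_ (does-⇔ (mk⇔ sym sym) (a ≟ x) (x ≟ a))
  (cong₂ _∨_ (does-⇔ (mk⇔ sym sym) (cycleSuc N a ≟ x) (x ≟ cycleSuc N a))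
             (does-⇔ (mk⇔ suc≡a⇒x≡pred x≡pred⇒suc≡a)
                     (cycleSuc N x ≟ a) (x ≟ cyclePred N a)))
  where
  suc≡a⇒x≡pred : cycleSuc N x ≡ a → x ≡ cyclePred N a
  suc≡a⇒x≡pred eq = trans (sym (cyclePred-cycleSuc N x)) (cong (cyclePred N) eq)
  x≡pred⇒suc≡a : x ≡ cyclePred N a → cycleSuc N x ≡ a
  x≡pred⇒suc≡a eq = trans (cong (cycleSuc N) eq) (cycleSuc-cyclePred a<N)

≟-disjoint : ∀ {s t} x → s ≢ t → does (x ≟ s) ∧ does (x ≟ t) ≡ false
≟-disjoint {s} {t} x s≢t = on (x ≟ s)
  where
  on : (x≟s : Dec (x ≡ s)) → does x≟s ∧ does (x ≟ t) ≡ false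
  on (yes x≡s) = dec-false (x ≟ t) (s≢t ∘ trans (sym x≡s))
  on (no  _)   = refl

count-cycleNear : ∀ {r} a → a < 3 + r →
                  count {3 + r} (λ x → cycleNear (3 + r) a (toℕ x)) ≡ 3
count-cycleNear {r} a a<N = begin
  count {N} (λ x → cycleNear N a (toℕ x))
    ≡⟨ count-cong {N} (λ x → cycleNear-≟ N (toℕ x) a<N) ⟩
  count (λ x → is a x ∨ is a⁺ x ∨ is a⁻ x)
    ≡⟨ count-∨ (is a) (λ x → is a⁺ x ∨ is a⁻ x) (λ x → trans (∧-distribˡ-∨ (is a x) _ _)
         (cong₂ _∨_ (≟-disjoint (toℕ x) (cycleSuc-≢ {r} a))
                    (≟-disjoint (toℕ x) (cyclePred-≢ {r} a)))) ⟩
  count (is a) + count (λ x → is a⁺ x ∨ is a⁻ x)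
    ≡⟨ cong (count (is a) +_)
         (count-∨ (is a⁺) (is a⁻) (λ x → ≟-disjoint (toℕ x) (cycleSuc≢cyclePred {r} a))) ⟩
  count (is a) + (count (is a⁺) + count (is a⁻))
    ≡⟨ cong₂ _+_ (count-toℕ≡ {N} a a<N)
         (cong₂ _+_ (count-toℕ≡ {N} a⁺ (cycleSuc-< a<N))
                    (count-toℕ≡ {N} a⁻ (cyclePred-< a<N))) ⟩
  3 ∎
  where
  open ≡-Reasoning
  N = 3 + r
  a⁺ = cycleSuc N a
  a⁻ = cyclePred N a
  is : ℕ → Fin N → Bool
  is t x = does (toℕ x ≟ t)

cycleComplement : ℕ → Graph
cycleComplement N = record
  { n      = N
  ; adj    = λ u w → not (cycleNear N (toℕ u) (toℕ w))
  ; sym    = λ u w → cong not (cycleNear-sym N (toℕ u) (toℕ w))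
  ; irrefl = λ u → cong not (cycleNear-refl N (toℕ u))
  }

deg-cycleComplement : ∀ r v → deg (cycleComplement (3 + r)) v ≡ r
deg-cycleComplement r v = +-cancelʳ-≡ 3 _ r (begin
  deg (cycleComplement (3 + r)) v + 3
    ≡⟨ cong (count (not ∘ near) +_) (count-cycleNear (toℕ v) (toℕ<n v)) ⟨
  count (not ∘ near) + count near
    ≡⟨ count-not near ⟩
  3 + r
    ≡⟨ +-comm 3 r ⟩
  r + 3 ∎)
  where
  open ≡-Reasoning
  near = λ (w : Fin (3 + r)) → cycleNear (3 + r) (toℕ v) (toℕ w)

-- The witness for k = 2 + j; r = k² − 2, written without truncated subtraction.
module Witness (j : ℕ) where

  k m r N : ℕ
  k = 2 + j
  m = 1 + j
  r = j * j + 4 * j + 2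
  N = 3 + r

  G : Graph
  G = cone (cycleComplement N)

  k*k≡2+r : k * k ≡ 2 + r
  k*k≡2+r = identity j
    where
    identity : ∀ x → (2 + x) * (2 + x) ≡ 2 + (x * x + 4 * x + 2)
    identity = solve-∀

  N≡k*k+1 : N ≡ k * k + 1
  N≡k*k+1 = trans (+-comm 1 (2 + r)) (cong (_+ 1) (sym k*k≡2+r))

  k*k∸1≡1+r : k * k ∸ 1 ≡ 1 + r
  k*k∸1≡1+r = cong (_∸ 1) k*k≡2+r

  k*k∸1≡[k+1]*m : k * k ∸ 1 ≡ (k + 1) * m
  k*k∸1≡[k+1]*m = trans k*k∸1≡1+r (identity j)
    where
    identity : ∀ x → 1 + (x * x + 4 * x + 2) ≡ (2 + x + 1) * (1 + x)
    identity = solve-∀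

  k*k∸1<N : k * k ∸ 1 < N
  k*k∸1<N = subst (_< N) (sym k*k∸1≡1+r) (m<n+m (suc r) {2} z<s)

  N<k*[k+1] : N < k * suc k
  N<k*[k+1] = ≤-trans (m≤m+n (suc N) j) (≤-reflexive (identity j))
    where
    identity : ∀ x → 1 + (3 + (x * x + 4 * x + 2)) + x ≡ (2 + x) * (3 + x)
    identity = solve-∀

  deg-apex : deg G zero ≡ N
  deg-apex = deg-cone-apex (cycleComplement N)

  deg-rim : ∀ v → deg G (suc v) ≡ k * k ∸ 1
  deg-rim v = trans (cong suc (deg-cycleComplement r v)) (sym k*k∸1≡1+r)

  minDeg : minDeg≥ G (k * k ∸ 1)
  minDeg zero    = subst (k * k ∸ 1 ≤_) (sym deg-apex) (<⇒≤ k*k∸1<N)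
  minDeg (suc v) = ≤-reflexive (sym (deg-rim v))

  module _ (c : EdgeColouring G (k + 1)) (maj : IsMajority k G c) where

    rim-degCol≡m : ∀ v i → degCol G c (suc v) i ≡ m
    rim-degCol≡m v = degCol-≡ k G c maj (suc v) m
      (trans (deg-rim v) k*k∸1≡[k+1]*m) (≤-reflexive (cong suc (deg-rim v)))

    colourClass-even : ∀ i → 2 ∣ degCol G c zero i + N * m
    colourClass-even i = subst (2 ∣_)
      (cong (degCol G c zero i +_) (trans (sum-cong-≗ (λ v → rim-degCol≡m v i)) (∑-const N m)))
      (handshake (colourClass G c i))

    apex-degCol≢k : ∀ i → degCol G c zero i ≢ k
    apex-degCol≢k i d≡k = contradiction 1ℙ≡0ℙ λ ()
      where
      open ≡-Reasoning
      1ℙ≡0ℙ : 1ℙ ≡ 0ℙ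
      1ℙ≡0ℙ = begin
        1ℙ                                 ≡⟨ k+[k*k+1]*[k∸1]-odd k (s≤s z≤n) ⟨
        parity (k + (k * k + 1) * m)       ≡⟨ cong₂ (λ d n → parity (d + n * m)) d≡k N≡k*k+1 ⟨
        parity (degCol G c zero i + N * m) ≡⟨ parity-even (colourClass-even i) ⟩
        0ℙ                                 ∎

    apex-degCol≤m : ∀ i → degCol G c zero i ≤ m
    apex-degCol≤m i =
      s≤s⁻¹ (≤∧≢⇒< (degCol-≤ k G c maj zero k deg<k*[k+1] i) (apex-degCol≢k i))
      where
      deg<k*[k+1] : deg G zero < k * suc k
      deg<k*[k+1] = subst (_< k * suc k) (sym deg-apex) N<k*[k+1]

    N<N : N < N
    N<N = begin-strict
      N                                ≡⟨ deg-apex ⟨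
      deg G zero                       ≡⟨ ∑-degCol≡deg G c zero ⟨
      ∑[ i < k + 1 ] degCol G c zero i ≤⟨ ∑-≤ apex-degCol≤m ⟩
      (k + 1) * m                      ≡⟨ k*k∸1≡[k+1]*m ⟨
      k * k ∸ 1                        <⟨ k*k∸1<N ⟩
      N                                ∎
      where open ≤-Reasoning

  ¬colourable : ¬ MajorityColourable k G (k + 1)
  ¬colourable (c , maj) = <-irrefl refl (N<N c maj)

mainTheorem4 : (k : ℕ) → 2 ≤ k →
    Σ Graph (λ G → minDeg≥ G (k * k ∸ 1) × ¬ MajorityColourable k G (k + 1))
mainTheorem4 (suc zero)    (s≤s ())
mainTheorem4 (suc (suc j)) _ = G , minDeg , ¬colourable
  where open Witness j
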